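{- Let $G$ be a fascinating graph which is $1$-joinlike, witnessed by a partition $V(G)=C_1\sqcup C_2\sqcup\{q\}$, so $q$ is the exceptional vertex. Then $\deg(q,C_i)\geq 3$ for $i=1,2$.
   Context: For a graph $G$ and a vertex $v$, $N_v=\{w: vw\in E(G)\}$, and for $X\subseteq V(G)$, $\deg(v,X)=|N_v\cap X|$; $G[W]$ is the subgraph induced by $W$. For a clique $\sigma$, $\mathrm{lk}_G\sigma$ is the subgraph induced by $\bigcap_{v\in\sigma}N_v$. The length of a cycle is its number of vertices. A graph $G$ with $n$ vertices and $m$ edges is fascinating if: (a) $G$ contains exactly $2(m-n)$ triangles; (b) for every edge $e$, $\mathrm{lk}_G e$ is a cycle of length at least $4$; (c) for every triangle $t$, $\mathrm{lk}_G t$ is the graph with $2$ vertices and no edges; (d) for every vertex $v$, $\mathrm{lk}_G v$ is a connected planar graph whose every face (including the unbounded one) is a triangle, with at least $6$ vertices. A fascinating graph $G$ is $t$-joinlike if there is a partition $V(G)=C_1\sqcup C_2\sqcup X$ such that $G[C_1]$ and $G[C_2]$ are cycles, there are edges $e_i\in G[C_i]$ with $\mathrm{lk}_G e_i=G[C_{3-i}]$ for $i=1,2$, and $|X|=t$; the vertices of $X$ are called exceptional. -}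

module Defs where

open import Data.Nat using (ℕ; zero; suc; _+_; _*_; _≤_; _<ᵇ_)
open import Data.Fin using (Fin; toℕ) renaming (zero to fzero; suc to fsuc)
open import Data.Fin.Properties using (_≟_)
open import Data.Bool using (Bool; true; false; _∧_; if_then_else_)
open import Data.Product using (Σ; ∃; ∃-syntax; _×_; _,_)
open import Data.Sum using (_⊎_)
open import Function.Bundles using (_⇔_)
open import Function.Definitions using (Injective)
open import Relation.Binary.PropositionalEquality using (_≡_)
open import Relation.Nullary.Decidable using (⌊_⌋)

record Graph : Set where
  field
    size   : ℕ
    adj    : Fin size → Fin size → Bool
    sym    : ∀ u v → adj u v ≡ adj v u
    irrefl : ∀ v → adj v v ≡ false

Adj : ℕ → Set
Adj k = Fin k → Fin k → Bool

sumF : ∀ {n} → (Fin n → ℕ) → ℕ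
sumF {zero}  f = 0
sumF {suc n} f = f fzero + sumF (λ i → f (fsuc i))

count : ∀ {n} → (Fin n → Bool) → ℕ
count p = sumF (λ i → if p i then 1 else 0)

_<F_ : ∀ {n} → Fin n → Fin n → Bool
i <F j = toℕ i <ᵇ toℕ j

numEdges : ∀ {k} → Adj k → ℕ
numEdges A = sumF λ u → sumF λ v → if (u <F v) ∧ A u v then 1 else 0

numTriangles : ∀ {k} → Adj k → ℕ
numTriangles A = sumF λ u → sumF λ v → sumF λ w →
  if (u <F v) ∧ (v <F w) ∧ A u v ∧ A v w ∧ A u w then 1 else 0

-- An enumeration of S is an injective map Fin k → vertices with image S;
-- the induced subgraph G[S] is then (up to isomorphism) the graph on Fin k
-- with adjacency inducedAdj G f.

module _ (G : Graph) where
  open Graph G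

  Enumerates : ∀ {k} → (Fin size → Bool) → (Fin k → Fin size) → Set
  Enumerates S f = Injective _≡_ _≡_ f × (∀ v → (S v ≡ true) ⇔ (∃[ i ] f i ≡ v))

  inducedAdj : ∀ {k} → (Fin k → Fin size) → Adj k
  inducedAdj f i j = adj (f i) (f j)

  -- G[S] satisfies the (isomorphism-invariant) property P of graphs on Fin k
  InducedHas : (Fin size → Bool) → (∀ k → Adj k → Set) → Set
  InducedHas S P = ∃[ k ] Σ (Fin k → Fin size) λ f → Enumerates S f × P k (inducedAdj f)

  lkVertex : Fin size → Fin size → Bool
  lkVertex v w = adj v w

  lkEdge : Fin size → Fin size → Fin size → Bool
  lkEdge u v w = adj u w ∧ adj v w

  lkTriangle : Fin size → Fin size → Fin size → Fin size → Bool
  lkTriangle u v x w = adj u w ∧ adj v w ∧ adj x w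

  deg : Fin size → (Fin size → Bool) → ℕ
  deg v X = count (λ w → adj v w ∧ X w)

CycNext : ∀ k → Fin k → Fin k → Set
CycNext k i j = (toℕ j ≡ suc (toℕ i)) ⊎ (suc (toℕ i) ≡ k × toℕ j ≡ 0)

IsCycle : ∀ k → Adj k → Set
IsCycle k A = 3 ≤ k × (∀ i j → (A i j ≡ true) ⇔ (CycNext k i j ⊎ CycNext k j i))

IsCycle≥4 : ∀ k → Adj k → Set
IsCycle≥4 k A = 4 ≤ k × IsCycle k A

IsTwoIsolated : ∀ k → Adj k → Set
IsTwoIsolated k A = k ≡ 2 × (∀ i j → A i j ≡ false)

data Reach {k} (A : Adj k) (i : Fin k) : Fin k → Set where
  here : Reach A i i
  step : ∀ {j l} → Reach A i j → A j l ≡ true → Reach A i l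

Connected : ∀ k → Adj k → Set
Connected k A = ∀ i j → Reach A i j

iter : ∀ {X : Set} → (X → X) → ℕ → X → X
iter f zero    x = x
iter f (suc t) x = f (iter f t x)

-- A rotation system: rot v is a cyclic permutation of the neighbourhood of v
-- (maps neighbours to neighbours, and from any neighbour every neighbour is
-- reached after at least one step; this forces a single cycle).
IsRotation : ∀ {k} → Adj k → (Fin k → Fin k → Fin k) → Set
IsRotation A rot =
  (∀ v u → A v u ≡ true → A v (rot v u) ≡ true) ×
  (∀ v u w → A v u ≡ true → A v w ≡ true → ∃[ t ] iter (rot v) (suc t) u ≡ w)

-- Face permutation on darts (u,v): (u,v) ↦ (v, rot v u).  Every face is a
-- triangle iff applying it three times is the identity on every dart.
AllFacesTriangles : ∀ {k} → Adj k → (Fin k → Fin k → Fin k) → Set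
AllFacesTriangles A rot = ∀ u v → A u v ≡ true →
  let w = rot v u ; x = rot w v in x ≡ u × rot x w ≡ v

-- Connected planar graph all of whose faces (incl. the unbounded one) are
-- triangles: a connected graph with a cellular embedding (rotation system)
-- all of whose faces are triangles, on the sphere (Euler characteristic 2:
-- V - E + F = 2 where, faces being triangles, 3F = 2E).
IsPlanarTriangulation : ∀ k → Adj k → Set
IsPlanarTriangulation k A = Connected k A ×
  (∃[ rot ] IsRotation A rot × AllFacesTriangles A rot ×
    (∃[ F ] 3 * F ≡ 2 * numEdges A × k + F ≡ numEdges A + 2))

IsVertexLinkShape : ∀ k → Adj k → Set
IsVertexLinkShape k A = 6 ≤ k × IsPlanarTriangulation k A

Fascinating : Graph → Set
Fascinating G =
  -- (a) #triangles = 2(m - n), written without truncated subtraction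
  (numTriangles adj + 2 * size ≡ 2 * numEdges adj) ×
  (∀ u v → adj u v ≡ true → InducedHas G (lkEdge G u v) IsCycle≥4) ×
  (∀ u v x → adj u v ≡ true → adj v x ≡ true → adj u x ≡ true →
     InducedHas G (lkTriangle G u v x) IsTwoIsolated) ×
  (∀ v → InducedHas G (lkVertex G v) IsVertexLinkShape)
  where open Graph G

JoinlikeWitness : (G : Graph) → ℕ → (C₁ C₂ X : Fin (Graph.size G) → Bool) → Set
JoinlikeWitness G t C₁ C₂ X =
  (∀ v → (C₁ v ≡ true ⊎ C₂ v ≡ true ⊎ X v ≡ true)) ×
  (∀ v → C₁ v ≡ true → C₂ v ≡ false) ×
  (∀ v → C₁ v ≡ true → X v ≡ false) ×
  (∀ v → C₂ v ≡ true → X v ≡ false) ×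
  InducedHas G C₁ IsCycle × InducedHas G C₂ IsCycle ×
  (∃[ a ] ∃[ b ] C₁ a ≡ true × C₁ b ≡ true × adj a b ≡ true ×
     (∀ w → lkEdge G a b w ≡ C₂ w)) ×
  (∃[ a ] ∃[ b ] C₂ a ≡ true × C₂ b ≡ true × adj a b ≡ true ×
     (∀ w → lkEdge G a b w ≡ C₁ w)) ×
  count X ≡ t
  where open Graph G

singleton : ∀ {n} → Fin n → Fin n → Bool
singleton q v = ⌊ v ≟ q ⌋

-- Suppose q had at most two neighbours in C₁.  Every other neighbour lies in C₂,
-- so q, whose link has at least six vertices, has a neighbour in C₂.  If q ~ x and
-- x ~ y along the cycle G[C₂] but q ≁ y, the link of the edge qx would consist of
-- at most two vertices of C₁ and at most one cycle-neighbour of x, i.e. fewer than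
-- four vertices.  So adjacency to q spreads along G[C₂]: q is adjacent to all of C₂,
-- in particular to both ends of the edge e₂ ⊆ C₂, and thus lies in lk e₂ = G[C₁].
-- Swapping C₁ and C₂ gives the other bound.
module Submission where

open import Defs
open import Data.Bool using (Bool; true; false; _∧_; if_then_else_)
import Data.Bool.Properties as Bool
open import Data.Fin using (Fin; inject₁; punchIn) renaming (zero to fzero; suc to fsuc)
open import Data.Fin.Induction using (<-weakInduction)
open import Data.Fin.Properties
  using (_≟_; any?; toℕ-injective; toℕ<n; toℕ-inject₁; punchIn-injective; punchInᵢ≢i)
  renaming (suc-injective to fsuc-injective; 0≢1+n to fzero≢fsuc)
open import Data.Nat using (zero; suc; _+_; _≤_; z≤n; s≤s)
open import Data.Nat.Properties
  using (≤-trans; ≤-reflexive; m≤n⇒m≤1+n; +-suc; <⇒≢; ≰⇒>; suc-injective; 0≢1+n)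
open import Data.Product using (∃-syntax; _×_; _,_; proj₁; proj₂)
open import Data.Sum using (_⊎_; inj₁; inj₂; [_,_]′; swap)
open import Function using (id; _∘_)
open import Function.Bundles using (Equivalence)
open import Function.Definitions using (Injective)
open import Relation.Binary.PropositionalEquality
  using (_≡_; _≢_; refl; sym; trans; cong; cong₂; subst)
open import Relation.Nullary using (yes; no; does; contradiction)
open import Relation.Nullary.Decidable using (dec-false; toWitness; fromWitness)

open Equivalence using (to; from)

_without_ : ∀ {n} → (Fin n → Bool) → Fin n → Fin n → Bool
(p without x) v = if does (v ≟ x) then false else p v

count-without : ∀ {n} (p : Fin n → Bool) {x} → p x ≡ true → count p ≡ suc (count (p without x))
count-without {suc n} p {fzero} px rewrite px = refl
count-without {suc n} p {fsuc x} px =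
  trans (cong ((if p fzero then 1 else 0) +_) (count-without (p ∘ fsuc) px)) (+-suc _ _)

count-≥-injection : ∀ {n k} (p : Fin n → Bool) {f : Fin k → Fin n} →
  Injective _≡_ _≡_ f → (∀ i → p (f i) ≡ true) → k ≤ count p
count-≥-injection {k = zero}  _ _ _ = z≤n
count-≥-injection {k = suc k} p {f} f-inj pf =
  ≤-trans (s≤s (count-≥-injection (p without f fzero) (fsuc-injective ∘ f-inj) fresh))
          (≤-reflexive (sym (count-without p (pf fzero))))
  where
  fresh : ∀ i → (p without f fzero) (f (fsuc i)) ≡ true
  fresh i rewrite dec-false (f (fsuc i) ≟ f fzero) (fzero≢fsuc ∘ sym ∘ f-inj) = pf (fsuc i)

count-≥-injection-but-one : ∀ {n k} (p : Fin n → Bool) (Q : Fin n → Set) →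
  (∀ {x y} → Q x → Q y → x ≡ y) → {f : Fin k → Fin n} → Injective _≡_ _≡_ f →
  (∀ i → p (f i) ≡ true ⊎ Q (f i)) → k ≤ suc (count p)
count-≥-injection-but-one {k = zero}  _ _ _ _ _ = z≤n
count-≥-injection-but-one {k = suc k} p Q Q-unique {f} f-inj pf
  with any? (λ i → p (f i) Bool.≟ false)
... | no none = m≤n⇒m≤1+n (count-≥-injection p f-inj λ i → Bool.¬-not λ e → none (i , e))
... | yes (i₀ , pfi₀≡false) =
  s≤s (count-≥-injection p (λ e → punchIn-injective i₀ _ _ (f-inj e)) in-p)
  where
  Qfi₀ : Q (f i₀)
  Qfi₀ = [ (λ e → contradiction (trans (sym e) pfi₀≡false) λ ()) , id ]′ (pf i₀)
  in-p : ∀ i → p (f (punchIn i₀ i)) ≡ true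
  in-p i = [ id , (λ Qfi → contradiction (f-inj (Q-unique Qfi Qfi₀)) (punchInᵢ≢i i₀ i)) ]′
             (pf (punchIn i₀ i))

CycAdj : ∀ k → Fin k → Fin k → Set
CycAdj k i j = CycNext k i j ⊎ CycNext k j i

CycNext-functional : ∀ {k} {i j₁ j₂ : Fin k} → CycNext k i j₁ → CycNext k i j₂ → j₁ ≡ j₂
CycNext-functional (inj₁ e₁)       (inj₁ e₂)       = toℕ-injective (trans e₁ (sym e₂))
CycNext-functional {j₁ = j₁} (inj₁ e₁) (inj₂ (e₂ , _)) = contradiction (trans e₁ e₂) (<⇒≢ (toℕ<n j₁))
CycNext-functional {j₂ = j₂} (inj₂ (e₁ , _)) (inj₁ e₂) = contradiction (trans e₂ e₁) (<⇒≢ (toℕ<n j₂))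
CycNext-functional (inj₂ (_ , e₁)) (inj₂ (_ , e₂)) = toℕ-injective (trans e₁ (sym e₂))

CycNext-injective : ∀ {k} {i₁ i₂ j : Fin k} → CycNext k i₁ j → CycNext k i₂ j → i₁ ≡ i₂
CycNext-injective (inj₁ e₁)       (inj₁ e₂)       = toℕ-injective (suc-injective (trans (sym e₁) e₂))
CycNext-injective (inj₁ e₁)       (inj₂ (_ , e₂)) = contradiction (trans (sym e₂) e₁) 0≢1+n
CycNext-injective (inj₂ (_ , e₁)) (inj₁ e₂)       = contradiction (trans (sym e₁) e₂) 0≢1+n
CycNext-injective (inj₂ (e₁ , _)) (inj₂ (e₂ , _)) = toℕ-injective (suc-injective (trans e₁ (sym e₂)))

CycAdj-other-unique : ∀ {k} {i j j₁ j₂ : Fin k} → CycAdj k i j → CycAdj k i j₁ → CycAdj k i j₂ →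
  j₁ ≢ j → j₂ ≢ j → j₁ ≡ j₂
CycAdj-other-unique _       (inj₁ n₁) (inj₁ n₂) _    _    = CycNext-functional n₁ n₂
CycAdj-other-unique _       (inj₂ p₁) (inj₂ p₂) _    _    = CycNext-injective p₁ p₂
CycAdj-other-unique (inj₁ n) (inj₁ n₁) (inj₂ _) j₁≢j _    = contradiction (CycNext-functional n₁ n) j₁≢j
CycAdj-other-unique (inj₂ p) (inj₂ p₁) (inj₁ _) j₁≢j _    = contradiction (CycNext-injective p₁ p) j₁≢j
CycAdj-other-unique (inj₁ n) (inj₂ _) (inj₁ n₂) _    j₂≢j = contradiction (CycNext-functional n₂ n) j₂≢j
CycAdj-other-unique (inj₂ p) (inj₁ _) (inj₂ p₂) _    j₂≢j = contradiction (CycNext-injective p₂ p) j₂≢j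

CycAdj-connected : ∀ {k} (P : Fin k → Set) → (∀ {i j} → CycAdj k i j → P i → P j) →
  ∀ {i} → P i → ∀ j → P j
CycAdj-connected {suc k} P closed {i} Pi =
  <-weakInduction P (to-zero i Pi) (λ j → closed (inj₁ (next j)))
  where
  next : ∀ j → CycNext (suc k) (inject₁ j) (fsuc j)
  next j = inj₁ (cong suc (sym (toℕ-inject₁ j)))
  to-zero : ∀ i → P i → P fzero
  to-zero = <-weakInduction (λ i → P i → P fzero) id (λ j back → back ∘ closed (inj₂ (next j)))

module _ (G : Graph) where
  open Graph G

  enumerates-member : ∀ {S : Fin size → Bool} {k} {f : Fin k → Fin size} →
    Enumerates G S f → ∀ i → S (f i) ≡ true
  enumerates-member {f = f} (_ , f-enum) i = from (f-enum (f i)) (i , refl)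

  enumerates-index : ∀ {S : Fin size → Bool} {k} {f : Fin k → Fin size} →
    Enumerates G S f → ∀ {v} → S v ≡ true → ∃[ i ] f i ≡ v
  enumerates-index (_ , f-enum) {v} = to (f-enum v)

HasEdgeWithLink : (G : Graph) → (B A : Fin (Graph.size G) → Bool) → Set
HasEdgeWithLink G B A = ∃[ a ] ∃[ b ] B a ≡ true × B b ≡ true × Graph.adj G a b ≡ true ×
  (∀ w → lkEdge G a b w ≡ A w)

module OneExceptionalVertex
  (G : Graph)
  (edge-links : ∀ u v → Graph.adj G u v ≡ true → InducedHas G (lkEdge G u v) IsCycle≥4)
  (vertex-links : ∀ v → InducedHas G (lkVertex G v) IsVertexLinkShape)
  (A B : Fin (Graph.size G) → Bool) (q : Fin (Graph.size G))
  (covers : ∀ v → v ≢ q → A v ≡ true ⊎ B v ≡ true)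
  {m} {h : Fin m → Fin (Graph.size G)}
  (h-enum : Enumerates G B h) (h-cycle : IsCycle m (inducedAdj G h))
  (few : deg G q A ≤ 2)
  where
  open Graph G renaming (sym to adj-sym)

  neighbour-in-A-or-B : ∀ {w} → adj q w ≡ true → A w ≡ true ⊎ B w ≡ true
  neighbour-in-A-or-B {w} q~w = covers w λ { refl → contradiction (trans (sym q~w) (irrefl q)) λ () }

  vertex-link-≤2 : (∀ {w} → adj q w ≡ true → B w ≡ false) →
    ∀ {k} {g : Fin k → Fin size} → Enumerates G (lkVertex G q) g → k ≤ 2
  vertex-link-≤2 no-B {g = g} g-enum = ≤-trans (count-≥-injection _ (proj₁ g-enum) neighbours-in-A) few
    where
    neighbours-in-A : ∀ t → adj q (g t) ∧ A (g t) ≡ true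
    neighbours-in-A t = cong₂ _∧_ q~v
      ([ id , (λ Bv → contradiction (trans (sym Bv) (no-B q~v)) λ ()) ]′ (neighbour-in-A-or-B q~v))
      where
      q~v : adj q (g t) ≡ true
      q~v = enumerates-member G g-enum t

  has-neighbour-in-B : ∃[ i ] adj q (h i) ≡ true
  has-neighbour-in-B with any? (λ i → adj q (h i) Bool.≟ true) | vertex-links q
  ... | yes found | _ = found
  ... | no none | _ , _ , g-enum , 6≤k , _ =
    contradiction (≤-trans 6≤k (vertex-link-≤2 no-B g-enum)) λ { (s≤s (s≤s ())) }
    where
    no-B : ∀ {w} → adj q w ≡ true → B w ≡ false
    no-B q~w = Bool.¬-not λ Bw → let i , hi≡w = enumerates-index G h-enum Bw in
      none (i , subst (λ v → adj q v ≡ true) (sym hi≡w) q~w)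

  edge-link-≤3 : ∀ {i j} → CycAdj m i j → adj q (h j) ≡ false →
    ∀ {k} {g : Fin k → Fin size} → Enumerates G (lkEdge G q (h i)) g → k ≤ 3
  edge-link-≤3 {i} {j} i~j q≁hj g-enum =
    ≤-trans (count-≥-injection-but-one _ Other Other-unique (proj₁ g-enum)
               (classify ∘ enumerates-member G g-enum))
            (s≤s few)
    where
    Other : Fin size → Set
    Other v = ∃[ j′ ] h j′ ≡ v × CycAdj m i j′ × j′ ≢ j
    Other-unique : ∀ {v w} → Other v → Other w → v ≡ w
    Other-unique (j₁ , refl , i~j₁ , j₁≢j) (j₂ , refl , i~j₂ , j₂≢j) =
      cong h (CycAdj-other-unique i~j i~j₁ i~j₂ j₁≢j j₂≢j)
    classify : ∀ {v} → lkEdge G q (h i) v ≡ true → adj q v ∧ A v ≡ true ⊎ Other v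
    classify {v} q,hi~v
      with Bool.∧-conicalˡ (adj q v) _ q,hi~v | Bool.∧-conicalʳ _ (adj (h i) v) q,hi~v
    ... | q~v | hi~v with neighbour-in-A-or-B q~v
    ... | inj₁ Av = inj₁ (cong₂ _∧_ q~v Av)
    ... | inj₂ Bv with enumerates-index G h-enum Bv
    ... | j′ , refl = inj₂ (j′ , refl , to (proj₂ h-cycle i j′) hi~v ,
                            λ { refl → contradiction (trans (sym q~v) q≁hj) λ () })

  adjacency-spreads : ∀ {i j} → CycAdj m i j → adj q (h i) ≡ true → adj q (h j) ≡ true
  adjacency-spreads {i} i~j q~hi with edge-links q (h i) q~hi
  ... | _ , _ , g-enum , 4≤k , _ =
    Bool.¬-not λ q≁hj → contradiction (≤-trans 4≤k (edge-link-≤3 i~j q≁hj g-enum))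
      λ { (s≤s (s≤s (s≤s ()))) }

  adjacent-to-all-of-B : ∀ i → adj q (h i) ≡ true
  adjacent-to-all-of-B =
    CycAdj-connected (λ i → adj q (h i) ≡ true) adjacency-spreads (proj₂ has-neighbour-in-B)

  q-in-A : HasEdgeWithLink G B A → A q ≡ true
  q-in-A (a , b , Ba , Bb , _ , lk≡A) =
    trans (sym (lk≡A q)) (cong₂ _∧_ (adjacent-to-B Ba) (adjacent-to-B Bb))
    where
    adjacent-to-B : ∀ {w} → B w ≡ true → adj w q ≡ true
    adjacent-to-B Bw with enumerates-index G h-enum Bw
    ... | i , refl = trans (adj-sym (h i) q) (adjacent-to-all-of-B i)

exceptional-degree-≥3 : (G : Graph) →
  (∀ u v → Graph.adj G u v ≡ true → InducedHas G (lkEdge G u v) IsCycle≥4) →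
  (∀ v → InducedHas G (lkVertex G v) IsVertexLinkShape) →
  (A B : Fin (Graph.size G) → Bool) (q : Fin (Graph.size G)) →
  (∀ v → v ≢ q → A v ≡ true ⊎ B v ≡ true) → A q ≢ true →
  InducedHas G B IsCycle → HasEdgeWithLink G B A → 3 ≤ deg G q A
exceptional-degree-≥3 G edge-links vertex-links A B q covers q∉A (_ , _ , h-enum , h-cycle) e =
  ≰⇒> λ few → q∉A (q-in-A few e)
  where open OneExceptionalVertex G edge-links vertex-links A B q covers h-enum h-cycle

proposition4p1 : (G : Graph) → (C₁ C₂ : Fin (Graph.size G) → Bool) → (q : Fin (Graph.size G)) →
    Fascinating G → JoinlikeWitness G 1 C₁ C₂ (singleton q) →
    (3 ≤ deg G q C₁) × (3 ≤ deg G q C₂)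
proposition4p1 G C₁ C₂ q (_ , edge-links , _ , vertex-links)
                        (part , _ , C₁∌X , C₂∌X , C₁-cycle , C₂-cycle , e₁ , e₂ , _) =
    exceptional-degree-≥3 G edge-links vertex-links C₁ C₂ q covers
      (Bool.not-¬ q∈X ∘ C₁∌X q) C₂-cycle e₂
  , exceptional-degree-≥3 G edge-links vertex-links C₂ C₁ q (λ v → swap ∘ covers v)
      (Bool.not-¬ q∈X ∘ C₂∌X q) C₁-cycle e₁
  where
  q∈X : singleton q q ≡ true
  q∈X = to Bool.T-≡ (fromWitness {a? = q ≟ q} refl)
  covers : ∀ v → v ≢ q → C₁ v ≡ true ⊎ C₂ v ≡ true
  covers v v≢q with part v
  ... | inj₁ C₁v        = inj₁ C₁v
  ... | inj₂ (inj₁ C₂v) = inj₂ C₂v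
  ... | inj₂ (inj₂ v∈X) = contradiction (toWitness {a? = v ≟ q} (from Bool.T-≡ v∈X)) v≢q
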